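{- Let $\boldsymbol{\alpha}=(\alpha_1,\dots,\alpha_r)$ and $\boldsymbol{\beta}=(\beta_1,\dots,\beta_s)$ be tuples of parameters in $\mathbb{Q}\setminus\mathbb{Z}_{\le0}$. Then $F_{\boldsymbol{\alpha},\boldsymbol{\beta}}$ is $N$-integral if and only if there exists $C_0\in\mathbb{N}$ such that $F_{\boldsymbol{\alpha},\boldsymbol{\beta}}(z)\in\mathbb{Z}_p[[z]]$ for all primes $p\geq C_0$.
   Context: $(x)_n=x(x+1)\cdots(x+n-1)$, $(x)_0=1$. $F_{\boldsymbol{\alpha},\boldsymbol{\beta}}(z)=\sum_{n\ge0}\frac{(\alpha_1)_n\cdots(\alpha_r)_n}{(\beta_1)_n\cdots(\beta_s)_n}z^n$. A power series $f\in\mathbb{C}[[z]]$ is $N$-integral if there exists $c\in\mathbb{Q}\setminus\{0\}$ with $f(cz)\in\mathbb{Z}[[z]]$. -}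

module Defs where

open import Data.Nat as ℕ using (ℕ; zero; suc)
open import Data.Nat.Divisibility using (_∣_)
open import Data.Integer as ℤ using (ℤ; +_; +[1+_]; -[1+_])
open import Data.Rational as ℚ using (ℚ; mkℚ; 0ℚ; 1ℚ; _+_; _*_; -_; 1/_; _/_; ↧ₙ_)
open import Data.List using (List; foldr)
open import Data.Product using (∃; ∃-syntax; _×_)
open import Relation.Binary.PropositionalEquality using (_≡_; _≢_)
open import Relation.Nullary using (¬_)

ℕ→ℚ : ℕ → ℚ
ℕ→ℚ n = (+ n) / 1

_^_ : ℚ → ℕ → ℚ
q ^ zero  = 1ℚ
q ^ suc n = (q ^ n) * q

-- total reciprocal: 1/q for q ≠ 0, and 0 at 0 (only ever applied to nonzero values
-- under the theorem's hypotheses)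
inv : ℚ → ℚ
inv (mkℚ (+ zero)   _ _) = 0ℚ
inv q@(mkℚ +[1+ _ ] _ _) = 1/ q
inv q@(mkℚ -[1+ _ ] _ _) = 1/ q

poch : ℚ → ℕ → ℚ
poch x zero    = 1ℚ
poch x (suc n) = poch x n * (x + ℕ→ℚ n)

prod : List ℚ → ℚ
prod = foldr _*_ 1ℚ

-- n-th coefficient of F_{α,β}(z):  (α₁)_n⋯(α_r)_n / ((β₁)_n⋯(β_s)_n)
hypCoeff : List ℚ → List ℚ → ℕ → ℚ
hypCoeff αs βs n = prod (Data.List.map (λ a → poch a n) αs) * inv (prod (Data.List.map (λ b → poch b n) βs))

NonPosInt : ℚ → Set
NonPosInt q = ∃[ k ] q ≡ - ℕ→ℚ k

IsInt : ℚ → Set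
IsInt q = ∃[ z ] q ≡ z / 1

-- q ∈ ℤ_p  (q written in lowest terms: p does not divide the denominator)
InZp : ℕ → ℚ → Set
InZp p q = ¬ (p ∣ ↧ₙ q)

-- a power series with coefficients a : ℕ → ℚ is N-integral:
-- ∃ c ∈ ℚ∖{0} with f(cz) ∈ ℤ[[z]]
NIntegral : (ℕ → ℚ) → Set
NIntegral a = ∃[ c ] (c ≢ 0ℚ × (∀ n → IsInt ((c ^ n) * a n)))

-- (⇒) holds for any power series: if c = u/w and c^n a_n ∈ ℤ for all n, the denominator of
-- a_n divides u^n, so only primes dividing u occur in denominators; take C₀ = |u| + 1.
-- (⇐) Clearing denominators, a_n = N_n / D_n with the nonzero integer
--   D_n = ∏_α den(α)^n · ∏_β ∏_{k<n} (num(β) + k·den(β)).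
-- The key estimate is that the p-adic valuation of a product ∏_{k<n} (b + k e) over an
-- arithmetic progression with gcd(b, e) = 1 is at most n (1 + |b| + e), uniformly in p: a
-- window of p^j consecutive indices contains at most one term divisible by p^j, and the
-- resulting Legendre-type sum is at most n.  Hence v_q(D_n) ≤ n K for a constant K and every
-- prime q.  As the primes dividing den(a_n) are < C₀, every prime power dividing den(a_n)
-- divides ((C₀!)^K)^n, so den(a_n) ∣ L^n with L = (C₀!)^K, and c = L works.
module Submission where

open import Defs renaming (_^_ to _^ℚ_)
open import Data.Nat using (ℕ; _≥_)
open import Data.Nat.Primality using (Prime)
open import Data.Rational using (ℚ)
open import Data.List using (List)
open import Data.List.Relation.Unary.All using (All)
open import Data.Product using (∃-syntax)
open import Function.Bundles using (_⇔_)
open import Relation.Nullary using (¬_)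

open import Data.Nat
  using (zero; suc; _+_; _*_; _^_; _∸_; _≤_; _<_; _/_; _%_; _!; z≤n; s≤s; NonZero;
         ≢-nonZero; ≢-nonZero⁻¹; >-nonZero; nonTrivial⇒n>1)
open import Data.Nat.Properties
open import Data.Nat.Divisibility
open import Data.Nat.DivMod using (m/n/o≡m/[n*o]; /-congʳ; m/n*n≤m; m≡m%n+[m/n]*n; m%n≤n)
open import Data.Nat.Primality using (prime⇒nonZero; prime⇒nonTrivial; prime⇒irreducible; euclidsLemma)
open import Data.Nat.Coprimality using (Coprime; coprime-divisor; recompute) renaming (sym to Coprime-sym)
open import Data.Nat.GCD using (gcd-zeroʳ)
open import Data.Nat.Primality.Factorisation using (factorise; PrimeFactorisation)
open import Data.Nat.ListAction using (sum; product)
open import Data.Nat.Tactic.RingSolver using (solve-∀)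
open import Data.Integer as ℤ using (ℤ; +_; ∣_∣)
import Data.Integer.Properties as ℤP
import Data.Integer.Divisibility.Signed as ℤDiv
import Data.Integer.Tactic.RingSolver as ℤSolver
import Data.Integer.GCD as ℤGCD
open import Data.Rational as ℚ using (mkℚ; 0ℚ; 1ℚ; ↥_; ↧_; ↧ₙ_)
import Data.Rational.Properties as ℚP
open import Data.Rational.Solver using () renaming (module +-*-Solver to ℚSolver)
import Data.Rational.Unnormalised as ℚᵘ
import Data.Rational.Unnormalised.Properties as ℚᵘP
open import Data.List using ([]; _∷_; foldr; map)
open import Data.List.Relation.Unary.All using ([]; _∷_) renaming (map to All-map)
open import Data.Product using (_,_; proj₁; proj₂)
open import Data.Sum using (inj₁; inj₂)
open import Function.Bundles using (mk⇔)
open import Relation.Nullary using (Dec; yes; no)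
open import Relation.Nullary.Negation using (contradiction)
open import Relation.Binary.PropositionalEquality

prime⇒≥2 : ∀ {p} → Prime p → 2 ≤ p
prime⇒≥2 {p} pp = nonTrivial⇒n>1 p {{prime⇒nonTrivial pp}}

exponent<power : ∀ {p} → 2 ≤ p → ∀ a → a < p ^ a
exponent<power {p} 2≤p zero    = s≤s z≤n
exponent<power {p} 2≤p (suc a) = begin-strict
  suc a             <⟨ s≤s (exponent<power 2≤p a) ⟩
  suc (p ^ a)       ≤⟨ +-monoˡ-≤ (p ^ a) (m^n>0 p a) ⟩
  p ^ a + p ^ a     ≡⟨ cong (_+_ (p ^ a)) (sym (+-identityʳ (p ^ a))) ⟩
  2 * p ^ a         ≤⟨ *-monoˡ-≤ (p ^ a) 2≤p ⟩
  p * p ^ a         ∎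
  where
  open ≤-Reasoning
  instance _ : NonZero p
  _ = >-nonZero (≤-trans (s≤s z≤n) 2≤p)

^-monoʳ-∣ : ∀ p {a c} → a ≤ c → p ^ a ∣ p ^ c
^-monoʳ-∣ p {a} {c} a≤c = divides (p ^ (c ∸ a)) (begin
  p ^ c                ≡⟨ cong (p ^_) (sym (m+[n∸m]≡n a≤c)) ⟩
  p ^ (a + (c ∸ a))    ≡⟨ ^-distribˡ-+-* p a (c ∸ a) ⟩
  p ^ a * p ^ (c ∸ a)  ≡⟨ *-comm (p ^ a) _ ⟩
  p ^ (c ∸ a) * p ^ a  ∎)
  where open ≡-Reasoning

^-monoˡ-∣ : ∀ {q Q} m → q ∣ Q → q ^ m ∣ Q ^ m
^-monoˡ-∣ zero    _   = ∣-refl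
^-monoˡ-∣ (suc m) q∣Q = *-pres-∣ q∣Q (^-monoˡ-∣ m q∣Q)

primePower-cancelˡ : ∀ {p} → Prime p → ∀ {x} → ¬ p ∣ x → ∀ a {y} → p ^ a ∣ x * y → p ^ a ∣ y
primePower-cancelˡ pp p∤x zero d = 1∣ _
primePower-cancelˡ {p} pp {x} p∤x (suc a) {y} d with euclidsLemma x y pp (m*n∣⇒m∣ p (p ^ a) d)
... | inj₁ p∣x = contradiction p∣x p∤x
... | inj₂ (divides q refl) =
  subst (p * p ^ a ∣_) (*-comm p q) (*-monoʳ-∣ p (primePower-cancelˡ pp p∤x a p^a∣xq))
  where
  instance _ = prime⇒nonZero pp
  regroup : ∀ x q p → x * (q * p) ≡ p * (x * q)
  regroup = solve-∀
  p^a∣xq : p ^ a ∣ x * q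
  p^a∣xq = *-cancelˡ-∣ p (subst (p * p ^ a ∣_) (regroup x q p) d)

ExpBound : ℕ → ℕ → ℕ → Set
ExpBound p x B = ∀ a → p ^ a ∣ x → a ≤ B

expBound-weaken : ∀ {p x B B′} → ExpBound p x B → B ≤ B′ → ExpBound p x B′
expBound-weaken bound B≤B′ a d = ≤-trans (bound a d) B≤B′

expBound-one : ∀ {p} → Prime p → ExpBound p 1 0
expBound-one pp zero    _ = z≤n
expBound-one {p} pp (suc a) d = contradiction (∣⇒≤ (m*n∣⇒m∣ p (p ^ a) d)) (<⇒≱ (prime⇒≥2 pp))

expBound-self : ∀ {p} → Prime p → ∀ x → x ≢ 0 → ExpBound p x x
expBound-self {p} pp x x≢0 a d =
  <⇒≤ (<-≤-trans (exponent<power (prime⇒≥2 pp) a) (∣⇒≤ {{≢-nonZero x≢0}} d))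

expBound-* : ∀ {p} → Prime p → ∀ B₁ {x y B₂} →
             ExpBound p x B₁ → ExpBound p y B₂ → ExpBound p (x * y) (B₁ + B₂)
expBound-* {p} pp B₁ {x} {y} {B₂} bx by a d with p ∣? x
... | no p∤x = ≤-trans (by a (primePower-cancelˡ pp p∤x a d)) (m≤n+m B₂ B₁)
expBound-* {p} pp zero {x} bx by a d | yes p∣x =
  contradiction (bx 1 (subst (_∣ x) (sym (*-identityʳ p)) p∣x)) λ ()
expBound-* {p} pp (suc B₁) bx by zero d | yes _ = z≤n
expBound-* {p} pp (suc B₁) {.(q * p)} {y} bx by (suc a) d | yes (divides q refl) =
  s≤s (expBound-* pp B₁ bq by a (*-cancelˡ-∣ p (subst (p * p ^ a ∣_) (regroup q p y) d)))
  where
  instance _ = prime⇒nonZero pp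
  regroup : ∀ q p y → q * p * y ≡ p * (q * y)
  regroup = solve-∀
  bq : ExpBound p q B₁
  bq a′ d′ = ≤-pred (bx (suc a′) (subst (p * p ^ a′ ∣_) (*-comm p q) (*-monoʳ-∣ p d′)))

expBound-*ℤ : ∀ {p} → Prime p → ∀ i j {B₁ B₂} →
              ExpBound p ∣ i ∣ B₁ → ExpBound p ∣ j ∣ B₂ → ExpBound p ∣ i ℤ.* j ∣ (B₁ + B₂)
expBound-*ℤ {p} pp i j {B₁} bi bj =
  subst (λ z → ExpBound p z _) (sym (ℤP.abs-* i j)) (expBound-* pp B₁ bi bj)

sumTo : ℕ → (ℕ → ℕ) → ℕ
sumTo zero    f = 0
sumTo (suc n) f = sumTo n f + f n

sumTo-cong : ∀ n {f g} → (∀ i → f i ≡ g i) → sumTo n f ≡ sumTo n g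
sumTo-cong zero    f≡g = refl
sumTo-cong (suc n) f≡g = cong₂ _+_ (sumTo-cong n f≡g) (f≡g n)

sumTo-mono : ∀ n {f g} → (∀ i → i < n → f i ≤ g i) → sumTo n f ≤ sumTo n g
sumTo-mono zero    f≤g = z≤n
sumTo-mono (suc n) f≤g = +-mono-≤ (sumTo-mono n (λ i i<n → f≤g i (m<n⇒m<1+n i<n))) (f≤g n ≤-refl)

sumTo-zero : ∀ n → sumTo n (λ _ → 0) ≡ 0
sumTo-zero zero    = refl
sumTo-zero (suc n) = trans (+-identityʳ _) (sumTo-zero n)

sumTo-one : ∀ n → sumTo n (λ _ → 1) ≡ n
sumTo-one zero    = refl
sumTo-one (suc n) = trans (cong (_+ 1) (sumTo-one n)) (+-comm n 1)

sumTo-+ : ∀ n f g → sumTo n (λ i → f i + g i) ≡ sumTo n f + sumTo n g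
sumTo-+ zero    f g = refl
sumTo-+ (suc n) f g = trans (cong (_+ (f n + g n)) (sumTo-+ n f g)) (swap (sumTo n f) (sumTo n g) (f n) (g n))
  where
  swap : ∀ a b c d → (a + b) + (c + d) ≡ (a + c) + (b + d)
  swap = solve-∀

sumTo-comm : ∀ n m (g : ℕ → ℕ → ℕ) →
             sumTo n (λ k → sumTo m (λ j → g j k)) ≡ sumTo m (λ j → sumTo n (λ k → g j k))
sumTo-comm zero    m g = sym (sumTo-zero m)
sumTo-comm (suc n) m g = trans (cong (_+ sumTo m (λ j → g j n)) (sumTo-comm n m g))
  (sym (sumTo-+ m (λ j → sumTo n (λ k → g j k)) (λ j → g j n)))

sumTo-suc : ∀ n f → sumTo (suc n) f ≡ f 0 + sumTo n (λ i → f (suc i))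
sumTo-suc zero    f = +-comm 0 (f 0)
sumTo-suc (suc n) f = trans (cong (_+ f (suc n)) (sumTo-suc n f)) (+-assoc (f 0) _ _)

sumTo-split : ∀ m r f → sumTo (m + r) f ≡ sumTo m f + sumTo r (λ i → f (m + i))
sumTo-split m zero    f = trans (cong (λ z → sumTo z f) (+-identityʳ m)) (sym (+-identityʳ _))
sumTo-split m (suc r) f = begin
  sumTo (m + suc r) f                                ≡⟨ cong (λ z → sumTo z f) (+-suc m r) ⟩
  sumTo (m + r) f + f (m + r)                        ≡⟨ cong (_+ f (m + r)) (sumTo-split m r f) ⟩
  sumTo m f + sumTo r (λ i → f (m + i)) + f (m + r)  ≡⟨ +-assoc (sumTo m f) _ _ ⟩
  sumTo m f + sumTo (suc r) (λ i → f (m + i))        ∎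
  where open ≡-Reasoning

sumTo-≥ : ∀ J f a → a ≤ J → (∀ j → j < a → 1 ≤ f j) → a ≤ sumTo J f
sumTo-≥ J f a a≤J positive = begin
  a                                              ≡⟨ sym (sumTo-one a) ⟩
  sumTo a (λ _ → 1)                              ≤⟨ sumTo-mono a positive ⟩
  sumTo a f                                      ≤⟨ m≤m+n _ _ ⟩
  sumTo a f + sumTo (J ∸ a) (λ i → f (a + i))    ≡⟨ sym (sumTo-split a (J ∸ a) f) ⟩
  sumTo (a + (J ∸ a)) f                          ≡⟨ cong (λ m → sumTo m f) (m+[n∸m]≡n a≤J) ⟩
  sumTo J f                                      ∎
  where open ≤-Reasoning

divIndicator : ℕ → ℕ → ℕ
divIndicator q y with q ∣? y
... | yes _ = 1
... | no  _ = 0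

divIndicator-yes : ∀ {q y} → q ∣ y → divIndicator q y ≡ 1
divIndicator-yes {q} {y} q∣y with q ∣? y
... | yes _   = refl
... | no  q∤y = contradiction q∣y q∤y

divIndicator-no : ∀ {q y} → ¬ q ∣ y → divIndicator q y ≡ 0
divIndicator-no {q} {y} q∤y with q ∣? y
... | yes q∣y = contradiction q∣y q∤y
... | no  _   = refl

Spaced : ℕ → (ℕ → ℕ) → Set
Spaced q x = ∀ k i → q ∣ x k → q ∣ x (k + i) → q ∣ i

-- In a q-spaced sequence, among the first n terms at most 1 + ⌊n/q⌋ are divisible by q:
-- each block of q consecutive indices contains at most one of them.
module SpacedCount (q : ℕ) {{_ : NonZero q}} (x : ℕ → ℕ) (spaced : Spaced q x) where

  hits : ℕ → ℕ → ℕ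
  hits s m = sumTo m (λ i → divIndicator q (x (s + i)))

  hits-none : ∀ s m → (∀ i → i < m → ¬ q ∣ x (s + i)) → hits s m ≡ 0
  hits-none s zero    none = refl
  hits-none s (suc m) none =
    cong₂ _+_ (hits-none s m (λ i i<m → none i (m<n⇒m<1+n i<m))) (divIndicator-no (none m ≤-refl))

  -- a window of length at most q contains at most one hit: a hit at its last index
  -- excludes hits at all earlier indices, which would lie less than q apart
  hits-window : ∀ s m → m ≤ q → hits s m ≤ 1
  hits-window s zero    _   = z≤n
  hits-window s (suc m) 1+m≤q = byLastTerm (q ∣? x (s + m))
    where
    byLastTerm : Dec (q ∣ x (s + m)) → hits s (suc m) ≤ 1
    byLastTerm (no q∤last) = subst (_≤ 1) (sym noNewHit) (hits-window s m (≤-trans (n≤1+n m) 1+m≤q))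
      where
      noNewHit : hits s (suc m) ≡ hits s m
      noNewHit = trans (cong (_+_ (hits s m)) (divIndicator-no q∤last)) (+-identityʳ _)
    byLastTerm (yes q∣last) = ≤-reflexive (cong₂ _+_ (hits-none s m earlierMiss) (divIndicator-yes q∣last))
      where
      earlierMiss : ∀ i → i < m → ¬ q ∣ x (s + i)
      earlierMiss i i<m q∣xi = <-irrefl refl (≤-trans (s≤s (≤-trans q≤gap (m∸n≤m m i))) 1+m≤q)
        where
        reindex : s + i + (m ∸ i) ≡ s + m
        reindex = trans (+-assoc s i (m ∸ i)) (cong (_+_ s) (m+[n∸m]≡n (<⇒≤ i<m)))
        q≤gap : q ≤ m ∸ i
        q≤gap = ∣⇒≤ {{>-nonZero (m<n⇒0<n∸m i<m)}}
                    (spaced (s + i) (m ∸ i) q∣xi (subst (λ z → q ∣ x z) (sym reindex) q∣last))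

  hits-blocks : ∀ t s r → r ≤ q → hits s (t * q + r) ≤ suc t
  hits-blocks zero    s r r≤q = hits-window s r r≤q
  hits-blocks (suc t) s r r≤q = begin
    hits s (suc t * q + r)                ≡⟨ cong (hits s) (+-assoc q (t * q) r) ⟩
    hits s (q + (t * q + r))              ≡⟨ sumTo-split q (t * q + r) _ ⟩
    hits s q + sumTo (t * q + r) (λ i → divIndicator q (x (s + (q + i))))
      ≡⟨ cong (_+_ (hits s q)) (sumTo-cong (t * q + r) (λ i → cong (λ z → divIndicator q (x z)) (sym (+-assoc s q i)))) ⟩
    hits s q + hits (s + q) (t * q + r)   ≤⟨ +-mono-≤ (hits-window s q ≤-refl) (hits-blocks t (s + q) r r≤q) ⟩
    suc (suc t)                           ∎
    where open ≤-Reasoning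

  spaced-count : ∀ n → sumTo n (λ k → divIndicator q (x k)) ≤ suc (n / q)
  spaced-count n = subst (λ m → hits 0 m ≤ suc (n / q)) (sym n≡) (hits-blocks (n / q) 0 (n % q) (m%n≤n n q))
    where
    n≡ : n ≡ n / q * q + n % q
    n≡ = trans (m≡m%n+[m/n]*n n q) (+-comm (n % q) _)

-- Legendre-type estimate: Σ_{j<J} ⌊n / p^(j+1)⌋ ≤ n for a base p ≥ 2, because the first
-- quotient is at most n/2 and the remaining ones form the same sum for ⌊n/p⌋.
module _ (p : ℕ) {{_ : NonZero p}} (2≤p : 2 ≤ p) where

  quotPow : ℕ → ℕ → ℕ
  quotPow n k = _/_ n (p ^ k) {{m^n≢0 p k}}

  quotPow-suc : ∀ n j → quotPow n (suc (suc j)) ≡ quotPow (n / p) (suc j)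
  quotPow-suc n j = sym (m/n/o≡m/[n*o] n p (p ^ suc j) {{_}} {{m^n≢0 p (suc j)}} {{m^n≢0 p (suc (suc j))}})

  quotPow-one : ∀ n → quotPow n 1 ≡ n / p
  quotPow-one n = /-congʳ {{m^n≢0 p 1}} (*-identityʳ p)

  twice-quot≤ : ∀ n → n / p + n / p ≤ n
  twice-quot≤ n = begin
    n / p + n / p          ≡⟨ cong (_+_ (n / p)) (sym (+-identityʳ (n / p))) ⟩
    n / p + (n / p + 0)    ≡⟨ *-comm 2 (n / p) ⟩
    n / p * 2              ≤⟨ *-monoʳ-≤ (n / p) 2≤p ⟩
    n / p * p              ≤⟨ m/n*n≤m n p ⟩
    n                      ∎
    where open ≤-Reasoning

  legendre-sum≤ : ∀ J n → sumTo J (λ j → quotPow n (suc j)) ≤ n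
  legendre-sum≤ zero    n = z≤n
  legendre-sum≤ (suc J) n = begin
    sumTo (suc J) (λ j → quotPow n (suc j))               ≡⟨ sumTo-suc J _ ⟩
    quotPow n 1 + sumTo J (λ j → quotPow n (suc (suc j)))
      ≡⟨ cong₂ _+_ (quotPow-one n) (sumTo-cong J (quotPow-suc n)) ⟩
    n / p + sumTo J (λ j → quotPow (n / p) (suc j))      ≤⟨ +-monoʳ-≤ (n / p) (legendre-sum≤ J (n / p)) ⟩
    n / p + n / p                                         ≤⟨ twice-quot≤ n ⟩
    n                                                     ∎
    where open ≤-Reasoning

-- ∏_{k<n} (b + k·e); with b/e = x in lowest terms this is e^n · (x)_n.
progProduct : ℤ → ℤ → ℕ → ℤ
progProduct b e zero    = + 1
progProduct b e (suc n) = progProduct b e n ℤ.* (b ℤ.+ (+ n) ℤ.* e)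

-- The p-adic valuation of ∏_{k<n} (b + k e) is at most n (1 + |b| + e), provided no factor
-- vanishes and gcd(b, e) = 1.  Writing v_p(y) = Σ_{j<J} [p^(j+1) ∣ y] for J ≥ y and
-- exchanging the two sums, each inner count is at most 1 + ⌊n / p^(j+1)⌋ by spacing, and
-- the quotients add up to at most n by the Legendre-type estimate.
module ProgressionValuation (p : ℕ) (pp : Prime p) (b : ℤ) (e : ℕ)
       (nonvanishing : ∀ k → b ℤ.+ (+ k) ℤ.* (+ e) ≢ + 0)
       (coprime : Coprime ∣ b ∣ e) where

  instance _ = prime⇒nonZero pp

  term : ℕ → ℕ
  term k = ∣ b ℤ.+ (+ k) ℤ.* (+ e) ∣

  ∣ke∣ : ∀ k → ∣ (+ k) ℤ.* (+ e) ∣ ≡ k * e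
  ∣ke∣ k = ℤP.abs-* (+ k) (+ e)

  -- If p ∤ e, then p^(j+1) dividing term k and term (k + i) divides their difference i·e,
  -- hence i.  If p ∣ e, coprimality gives p ∤ b, so no term is divisible by p at all.
  term-spaced : ∀ j → Spaced (p ^ suc j) term
  term-spaced j k i d₁ d₂ with p ∣? e
  ... | no p∤e = primePower-cancelˡ pp p∤e (suc j) (subst (p ^ suc j ∣_) (*-comm i e) power∣ie)
    where
    shift : ∀ b k i e → b ℤ.+ (k ℤ.+ i) ℤ.* e ≡ (b ℤ.+ k ℤ.* e) ℤ.+ i ℤ.* e
    shift = ℤSolver.solve-∀
    later : b ℤ.+ (+ (k + i)) ℤ.* (+ e) ≡ (b ℤ.+ (+ k) ℤ.* (+ e)) ℤ.+ (+ i) ℤ.* (+ e)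
    later = trans (cong (λ z → b ℤ.+ z ℤ.* (+ e)) (ℤP.pos-+ k i)) (shift b (+ k) (+ i) (+ e))
    power∣ie : p ^ suc j ∣ i * e
    power∣ie = subst (p ^ suc j ∣_) (∣ke∣ i) (ℤDiv.∣⇒∣ᵤ
      (ℤDiv.∣m+n∣m⇒∣n {+ (p ^ suc j)} {b ℤ.+ (+ k) ℤ.* (+ e)} (ℤDiv.∣ᵤ⇒∣ (subst (λ z → p ^ suc j ∣ ∣ z ∣) later d₂)) (ℤDiv.∣ᵤ⇒∣ d₁)))
  ... | yes p∣e = contradiction (sym (coprime (p∣b , p∣e))) (<⇒≢ (prime⇒≥2 pp))
    where
    p∣ke : p ∣ ∣ (+ k) ℤ.* (+ e) ∣
    p∣ke = subst (p ∣_) (sym (∣ke∣ k)) (∣n⇒∣m*n k p∣e)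
    p∣b : p ∣ ∣ b ∣
    p∣b = ℤDiv.∣⇒∣ᵤ (ℤDiv.∣m+n∣n⇒∣m {+ p} {b} (ℤDiv.∣ᵤ⇒∣ (∣-trans (m∣m*n (p ^ j)) d₁)) (ℤDiv.∣ᵤ⇒∣ p∣ke))

  -- Truncated valuation Σ_{j<J} [p^(j+1) ∣ y]; it equals v_p(y) once J ≥ y.
  truncVal : ℕ → ℕ → ℕ
  truncVal J y = sumTo J (λ j → divIndicator (p ^ suc j) y)

  truncVal-bound : ∀ J y → y ≢ 0 → y ≤ J → ExpBound p y (truncVal J y)
  truncVal-bound J y y≢0 y≤J a p^a∣y = sumTo-≥ J _ a (≤-trans (expBound-self pp y y≢0 a p^a∣y) y≤J)
    (λ j j<a → ≤-reflexive (sym (divIndicator-yes (∣-trans (^-monoʳ-∣ p j<a) p^a∣y))))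

  bound : ℕ → ℕ
  bound n = ∣ b ∣ + n * e

  term≤bound : ∀ n k → k < n → term k ≤ bound n
  term≤bound n k k<n = begin
    term k                   ≤⟨ ℤP.∣i+j∣≤∣i∣+∣j∣ b ((+ k) ℤ.* (+ e)) ⟩
    ∣ b ∣ + ∣ (+ k) ℤ.* (+ e) ∣ ≡⟨ cong (_+_ ∣ b ∣) (∣ke∣ k) ⟩
    ∣ b ∣ + k * e            ≤⟨ +-monoʳ-≤ ∣ b ∣ (*-monoˡ-≤ e (<⇒≤ k<n)) ⟩
    bound n                  ∎
    where open ≤-Reasoning

  product-bound : ∀ n m → m ≤ n → ExpBound p ∣ progProduct b (+ e) m ∣ (sumTo m (λ k → truncVal (bound n) (term k)))
  product-bound n zero    _   = expBound-one pp
  product-bound n (suc m) m<n = expBound-*ℤ pp (progProduct b (+ e) m) _ (product-bound n m (≤-trans (n≤1+n m) m<n))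
    (truncVal-bound (bound n) (term m) (λ t≡0 → nonvanishing m (ℤP.∣i∣≡0⇒i≡0 t≡0)) (term≤bound n m m<n))

  truncVal-sum : ∀ n → sumTo n (λ k → truncVal (bound n) (term k)) ≤ n + bound n
  truncVal-sum n = begin
    sumTo n (λ k → truncVal top (term k))
      ≡⟨ sumTo-comm n top (λ j k → divIndicator (p ^ suc j) (term k)) ⟩
    sumTo top (λ j → sumTo n (λ k → divIndicator (p ^ suc j) (term k)))
      ≤⟨ sumTo-mono top (λ j _ → SpacedCount.spaced-count (p ^ suc j) {{m^n≢0 p (suc j)}} term (term-spaced j) n) ⟩
    sumTo top (λ j → suc (quotPow p (prime⇒≥2 pp) n (suc j)))
      ≡⟨ sumTo-cong top (λ j → +-comm 1 _) ⟩
    sumTo top (λ j → quotPow p (prime⇒≥2 pp) n (suc j) + 1)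
      ≡⟨ sumTo-+ top _ (λ _ → 1) ⟩
    sumTo top (λ j → quotPow p (prime⇒≥2 pp) n (suc j)) + sumTo top (λ _ → 1)
      ≤⟨ +-mono-≤ (legendre-sum≤ p (prime⇒≥2 pp) top n) (≤-reflexive (sumTo-one top)) ⟩
    n + top ∎
    where
    open ≤-Reasoning
    top = bound n

  progProduct-expBound : ∀ n → ExpBound p ∣ progProduct b (+ e) n ∣ (n * suc (∣ b ∣ + e))
  progProduct-expBound zero          = expBound-one pp
  progProduct-expBound n@(suc _) =
    expBound-weaken (product-bound n n ≤-refl) (≤-trans (truncVal-sum n) (total≤ n))
    where
    total≤ : ∀ n → .{{NonZero n}} → n + bound n ≤ n * suc (∣ b ∣ + e)
    total≤ n = begin
      n + (∣ b ∣ + n * e)        ≤⟨ +-monoʳ-≤ n (+-monoˡ-≤ (n * e) (m≤n*m ∣ b ∣ n)) ⟩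
      n + (n * ∣ b ∣ + n * e)    ≡⟨ expand n ∣ b ∣ e ⟩
      n * suc (∣ b ∣ + e)        ∎
      where
      open ≤-Reasoning
      expand : ∀ n c e → n + (n * c + n * e) ≡ n * (1 + (c + e))
      expand = solve-∀

open ProgressionValuation using (progProduct-expBound)

-- Peel off the first prime p: N = N₁ p, and prime powers dividing the rest divide N₁
-- (for q = p lose one factor p, for q ≠ p cancel the coprime factor p).
primePowers-divide-product : ∀ fs N → All Prime fs →
  (∀ q a → Prime q → q ^ a ∣ product fs → q ^ a ∣ N) → product fs ∣ N
primePowers-divide-product []       N _          _     = 1∣ N
primePowers-divide-product (p ∷ fs) N (pp ∷ pfs) local
  with m*n∣⇒m∣ p 1 (local p 1 pp (*-monoʳ-∣ p (1∣ product fs)))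
... | divides N₁ refl =
  subst (p * product fs ∣_) (*-comm p N₁) (*-monoʳ-∣ p (primePowers-divide-product fs N₁ pfs local′))
  where
  instance _ = prime⇒nonZero pp
  local′ : ∀ q a → Prime q → q ^ a ∣ product fs → q ^ a ∣ N₁
  local′ q a pq d with q ≟ p
  ... | yes refl = *-cancelˡ-∣ p (subst (p * p ^ a ∣_) (*-comm N₁ p) (local p (suc a) pp (*-monoʳ-∣ p d)))
  ... | no q≢p   = primePower-cancelˡ pq q∤p a
                     (subst (q ^ a ∣_) (*-comm N₁ p) (local q a pq (∣-trans d (∣n⇒∣m*n p ∣-refl))))
    where
    q∤p : ¬ q ∣ p
    q∤p q∣p with prime⇒irreducible pp q∣p
    ... | inj₁ q≡1 = <⇒≢ (prime⇒≥2 pq) (sym q≡1)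
    ... | inj₂ q≡p = q≢p q≡p

primePowers-divide : ∀ w N → .{{NonZero w}} →
  (∀ q a → Prime q → q ^ a ∣ w → q ^ a ∣ N) → w ∣ N
primePowers-divide w N local = subst (_∣ N) (sym isFactorisation)
  (primePowers-divide-product factors N factorsPrime (λ q a pq d → local q a pq (subst (q ^ a ∣_) (sym isFactorisation) d)))
  where open PrimeFactorisation (factorise w)

smallPrimePower∣factorial^ : ∀ {q C} a m → Prime q → q < C → a ≤ m → q ^ a ∣ (C !) ^ m
smallPrimePower∣factorial^ {q} {C} a m pq q<C a≤m = ∣-trans (^-monoʳ-∣ q a≤m) (^-monoˡ-∣ m (q∣C! q {{prime⇒nonZero pq}} (<⇒≤ q<C)))
  where
  q∣C! : ∀ q → .{{NonZero q}} → q ≤ C → q ∣ C !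
  q∣C! (suc q) q≤C = ∣-trans (m∣m*n (q !)) (m≤n⇒m!∣n! q≤C)

record Frac (q : ℚ) (s t : ℤ) : Set where
  constructor mkFrac
  field eq : q ℚ.* (t ℚ./ 1) ≡ s ℚ./ 1

toℚᵘ-int : ∀ s → ℚ.toℚᵘ (s ℚ./ 1) ℚᵘ.≃ ℚᵘ.mkℚᵘ s 0
toℚᵘ-int s = ℚP.toℚᵘ-fromℚᵘ (ℚᵘ.mkℚᵘ s 0)

frac⇒cross : ∀ q {s t} → Frac q s t → ↥ q ℤ.* t ≡ s ℤ.* ↧ q
frac⇒cross q@(mkℚ a d _) {s} {t} (mkFrac q·t≡s) with
  ℚᵘP.≃-trans (ℚᵘP.*-cong (ℚᵘP.≃-refl {ℚᵘ.mkℚᵘ a d}) (ℚᵘP.≃-sym (toℚᵘ-int t)))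
    (ℚᵘP.≃-trans (ℚᵘP.≃-sym (ℚP.toℚᵘ-homo-* q (t ℚ./ 1))) (ℚᵘP.≃-trans (ℚP.toℚᵘ-cong q·t≡s) (toℚᵘ-int s)))
... | ℚᵘ.*≡* cross = begin
  a ℤ.* t               ≡⟨ sym (ℤP.*-identityʳ _) ⟩
  a ℤ.* t ℤ.* + 1       ≡⟨ cross ⟩
  s ℤ.* + suc (d * 1)   ≡⟨ cong (λ x → s ℤ.* + suc x) (*-identityʳ d) ⟩
  s ℤ.* + suc d         ∎
  where open ≡-Reasoning

cross⇒frac : ∀ q s t → ↥ q ℤ.* t ≡ s ℤ.* ↧ q → Frac q s t
cross⇒frac q@(mkℚ a d _) s t cross = mkFrac (ℚP.toℚᵘ-injective
  (ℚᵘP.≃-trans (ℚP.toℚᵘ-homo-* q (t ℚ./ 1))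
  (ℚᵘP.≃-trans (ℚᵘP.*-cong (ℚᵘP.≃-refl {ℚᵘ.mkℚᵘ a d}) (toℚᵘ-int t))
  (ℚᵘP.≃-trans (ℚᵘ.*≡* cross′) (ℚᵘP.≃-sym (toℚᵘ-int s))))))
  where
  open ≡-Reasoning
  cross′ : a ℤ.* t ℤ.* + 1 ≡ s ℤ.* + suc (d * 1)
  cross′ = begin
    a ℤ.* t ℤ.* + 1       ≡⟨ ℤP.*-identityʳ _ ⟩
    a ℤ.* t               ≡⟨ cross ⟩
    s ℤ.* + suc d         ≡⟨ cong (λ x → s ℤ.* + suc x) (sym (*-identityʳ d)) ⟩
    s ℤ.* + suc (d * 1)   ∎

↥-int : ∀ a → ↥ (a ℚ./ 1) ≡ a
↥-int a = begin
  ↥ (a ℚ./ 1)                          ≡⟨ sym (ℤP.*-identityʳ _) ⟩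
  ↥ (a ℚ./ 1) ℤ.* + 1                  ≡⟨ cong (λ g → ↥ (a ℚ./ 1) ℤ.* + g) (sym (gcd-zeroʳ ∣ a ∣)) ⟩
  ↥ (a ℚ./ 1) ℤ.* ℤGCD.gcd a (+ 1)     ≡⟨ ℚP.↥-/ a 1 ⟩
  a                                    ∎
  where open ≡-Reasoning

↧-int : ∀ a → ↧ (a ℚ./ 1) ≡ + 1
↧-int a = begin
  ↧ (a ℚ./ 1)                          ≡⟨ sym (ℤP.*-identityʳ _) ⟩
  ↧ (a ℚ./ 1) ℤ.* + 1                  ≡⟨ cong (λ g → ↧ (a ℚ./ 1) ℤ.* + g) (sym (gcd-zeroʳ ∣ a ∣)) ⟩
  ↧ (a ℚ./ 1) ℤ.* ℤGCD.gcd a (+ 1)     ≡⟨ ℚP.↧-/ a 1 ⟩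
  + 1                                  ∎
  where open ≡-Reasoning

int-* : ∀ a b → (a ℚ./ 1) ℚ.* (b ℚ./ 1) ≡ (a ℤ.* b) ℚ./ 1
int-* a b = Frac.eq (cross⇒frac (a ℚ./ 1) (a ℤ.* b) b (begin
  ↥ (a ℚ./ 1) ℤ.* b            ≡⟨ cong (ℤ._* b) (↥-int a) ⟩
  a ℤ.* b                      ≡⟨ sym (ℤP.*-identityʳ _) ⟩
  a ℤ.* b ℤ.* + 1              ≡⟨ cong (ℤ._*_ (a ℤ.* b)) (sym (↧-int a)) ⟩
  a ℤ.* b ℤ.* ↧ (a ℚ./ 1)      ∎))
  where open ≡-Reasoning

int-+ : ∀ a b → (a ℚ./ 1) ℚ.+ (b ℚ./ 1) ≡ (a ℤ.+ b) ℚ./ 1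
int-+ a b = ℚP.toℚᵘ-injective
  (ℚᵘP.≃-trans (ℚP.toℚᵘ-homo-+ (a ℚ./ 1) (b ℚ./ 1))
  (ℚᵘP.≃-trans (ℚᵘP.+-cong (toℚᵘ-int a) (toℚᵘ-int b))
  (ℚᵘP.≃-trans (ℚᵘ.*≡* sum≡) (ℚᵘP.≃-sym (toℚᵘ-int (a ℤ.+ b))))))
  where
  sum≡ : (a ℤ.* + 1 ℤ.+ b ℤ.* + 1) ℤ.* + 1 ≡ (a ℤ.+ b) ℤ.* + 1
  sum≡ = cong (ℤ._* + 1) (cong₂ ℤ._+_ (ℤP.*-identityʳ a) (ℤP.*-identityʳ b))

int-injective : ∀ a b → a ℚ./ 1 ≡ b ℚ./ 1 → a ≡ b
int-injective a b a≡b = trans (sym (↥-int a)) (trans (cong ↥_ a≡b) (↥-int b))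

ℕ→ℚ-^ : ∀ L n → ℕ→ℚ L ^ℚ n ≡ (+ (L ^ n)) ℚ./ 1
ℕ→ℚ-^ L zero    = refl
ℕ→ℚ-^ L (suc n) = begin
  ℕ→ℚ L ^ℚ n ℚ.* ℕ→ℚ L                   ≡⟨ cong (ℚ._* ℕ→ℚ L) (ℕ→ℚ-^ L n) ⟩
  ((+ (L ^ n)) ℚ./ 1) ℚ.* ((+ L) ℚ./ 1)  ≡⟨ int-* (+ (L ^ n)) (+ L) ⟩
  (+ (L ^ n) ℤ.* + L) ℚ./ 1              ≡⟨ cong (ℚ._/ 1) (sym (ℤP.pos-* (L ^ n) L)) ⟩
  (+ (L ^ n * L)) ℚ./ 1                  ≡⟨ cong (λ z → (+ z) ℚ./ 1) (*-comm (L ^ n) L) ⟩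
  (+ (L * L ^ n)) ℚ./ 1                  ∎
  where open ≡-Reasoning

frac-self : ∀ q → Frac q (↥ q) (↧ q)
frac-self q = cross⇒frac q (↥ q) (↧ q) refl

frac-one : Frac 1ℚ (+ 1) (+ 1)
frac-one = mkFrac (ℚP.*-identityˡ _)

frac-* : ∀ x y {s s′ t t′} → Frac x s t → Frac y s′ t′ → Frac (x ℚ.* y) (s ℤ.* s′) (t ℤ.* t′)
frac-* x y {s} {s′} {t} {t′} (mkFrac x·t≡s) (mkFrac y·t′≡s′) = mkFrac (begin
  x ℚ.* y ℚ.* ((t ℤ.* t′) ℚ./ 1)                ≡⟨ cong (ℚ._*_ (x ℚ.* y)) (sym (int-* t t′)) ⟩
  x ℚ.* y ℚ.* ((t ℚ./ 1) ℚ.* (t′ ℚ./ 1))        ≡⟨ regroup x y (t ℚ./ 1) (t′ ℚ./ 1) ⟩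
  (x ℚ.* (t ℚ./ 1)) ℚ.* (y ℚ.* (t′ ℚ./ 1))      ≡⟨ cong₂ ℚ._*_ x·t≡s y·t′≡s′ ⟩
  (s ℚ./ 1) ℚ.* (s′ ℚ./ 1)                      ≡⟨ int-* s s′ ⟩
  (s ℤ.* s′) ℚ./ 1                              ∎)
  where
  open ≡-Reasoning
  open ℚSolver
  regroup : ∀ x y t t′ → x ℚ.* y ℚ.* (t ℚ.* t′) ≡ (x ℚ.* t) ℚ.* (y ℚ.* t′)
  regroup = solve 4 (λ x y t t′ → x :* y :* (t :* t′) := (x :* t) :* (y :* t′)) refl

frac-+ℕ : ∀ x {s t} k → Frac x s t → Frac (x ℚ.+ ℕ→ℚ k) (s ℤ.+ (+ k) ℤ.* t) t
frac-+ℕ x {s} {t} k (mkFrac x·t≡s) = mkFrac (begin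
  (x ℚ.+ ℕ→ℚ k) ℚ.* (t ℚ./ 1)                    ≡⟨ ℚP.*-distribʳ-+ (t ℚ./ 1) x _ ⟩
  x ℚ.* (t ℚ./ 1) ℚ.+ ℕ→ℚ k ℚ.* (t ℚ./ 1)        ≡⟨ cong₂ ℚ._+_ x·t≡s (int-* (+ k) t) ⟩
  (s ℚ./ 1) ℚ.+ ((+ k) ℤ.* t) ℚ./ 1              ≡⟨ int-+ s _ ⟩
  (s ℤ.+ (+ k) ℤ.* t) ℚ./ 1                      ∎)
  where open ≡-Reasoning

frac-zero : ∀ x {t} → Frac x (+ 0) t → t ≢ + 0 → x ≡ 0ℚ
frac-zero x x·t≡0 t≢0 with ℤP.i*j≡0⇒i≡0∨j≡0 (↥ x) (frac⇒cross x x·t≡0)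
... | inj₁ ↥x≡0 = ℚP.↥p≡0⇒p≡0 x ↥x≡0
... | inj₂ t≡0  = contradiction t≡0 t≢0

inv-inverseˡ : ∀ y → y ≢ 0ℚ → inv y ℚ.* y ≡ 1ℚ
inv-inverseˡ (mkℚ (+ zero) _ _)   y≢0 = contradiction (ℚP.↥p≡0⇒p≡0 _ refl) y≢0
inv-inverseˡ y@(mkℚ ℤ.+[1+ _ ] _ _) _ = ℚP.*-inverseˡ y
inv-inverseˡ y@(mkℚ ℤ.-[1+ _ ] _ _) _ = ℚP.*-inverseˡ y

frac-inv : ∀ y {s t} → Frac y s t → s ≢ + 0 → Frac (inv y) t s
frac-inv y {s} {t} (mkFrac y·t≡s) s≢0 = mkFrac (begin
  inv y ℚ.* (s ℚ./ 1)              ≡⟨ cong (ℚ._*_ (inv y)) (sym y·t≡s) ⟩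
  inv y ℚ.* (y ℚ.* (t ℚ./ 1))      ≡⟨ sym (ℚP.*-assoc (inv y) y _) ⟩
  (inv y ℚ.* y) ℚ.* (t ℚ./ 1)      ≡⟨ cong (ℚ._* (t ℚ./ 1)) (inv-inverseˡ y y≢0) ⟩
  1ℚ ℚ.* (t ℚ./ 1)                 ≡⟨ ℚP.*-identityˡ _ ⟩
  t ℚ./ 1                          ∎)
  where
  open ≡-Reasoning
  y≢0 : y ≢ 0ℚ
  y≢0 refl = s≢0 (sym (int-injective _ _ (trans (sym (ℚP.*-zeroˡ (t ℚ./ 1))) y·t≡s)))

den∣frac : ∀ q {s t} → Frac q s t → ↧ₙ q ∣ ∣ t ∣
den∣frac q@(mkℚ a d cop) {s} {t} q·t≡s = coprime-divisor (Coprime-sym (recompute cop)) (divides ∣ s ∣ cross)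
  where
  cross : ∣ a ∣ * ∣ t ∣ ≡ ∣ s ∣ * suc d
  cross = trans (sym (ℤP.abs-* a t)) (trans (cong ∣_∣ (frac⇒cross q q·t≡s)) (ℤP.abs-* s (+ suc d)))

frac-quotient : ∀ a x {U W} m → Frac x U W → x ℚ.* a ≡ m ℚ./ 1 → Frac a (m ℤ.* W) U
frac-quotient a x {U} {W} m (mkFrac x·W≡U) x·a≡m = mkFrac (begin
  a ℚ.* (U ℚ./ 1)                 ≡⟨ cong (ℚ._*_ a) (sym x·W≡U) ⟩
  a ℚ.* (x ℚ.* (W ℚ./ 1))         ≡⟨ regroup a x (W ℚ./ 1) ⟩
  (x ℚ.* a) ℚ.* (W ℚ./ 1)         ≡⟨ cong (ℚ._* (W ℚ./ 1)) x·a≡m ⟩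
  (m ℚ./ 1) ℚ.* (W ℚ./ 1)         ≡⟨ int-* m W ⟩
  (m ℤ.* W) ℚ./ 1                 ∎)
  where
  open ≡-Reasoning
  open ℚSolver
  regroup : ∀ a x w → a ℚ.* (x ℚ.* w) ≡ (x ℚ.* a) ℚ.* w
  regroup = solve 3 (λ a x w → a :* (x :* w) := (x :* a) :* w) refl

den∣⇒integral : ∀ a N → ↧ₙ a ∣ N → IsInt ((+ N) ℚ./ 1 ℚ.* a)
den∣⇒integral a N (divides k N≡k·den) =
  (+ k ℤ.* ↥ a) , trans (ℚP.*-comm _ a) (Frac.eq (cross⇒frac a (+ k ℤ.* ↥ a) (+ N) cross))
  where
  open ≡-Reasoning
  swap : ∀ a k d → a ℤ.* (k ℤ.* d) ≡ (k ℤ.* a) ℤ.* d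
  swap = ℤSolver.solve-∀
  cross : ↥ a ℤ.* + N ≡ (+ k ℤ.* ↥ a) ℤ.* ↧ a
  cross = begin
    ↥ a ℤ.* + N               ≡⟨ cong (λ z → ↥ a ℤ.* + z) N≡k·den ⟩
    ↥ a ℤ.* + (k * ↧ₙ a)      ≡⟨ cong (ℤ._*_ (↥ a)) (ℤP.pos-* k (↧ₙ a)) ⟩
    ↥ a ℤ.* (+ k ℤ.* ↧ a)     ≡⟨ swap (↥ a) (+ k) (↧ a) ⟩
    (+ k ℤ.* ↥ a) ℤ.* ↧ a     ∎

frac-pow : ∀ c {u w} n → Frac c u w → Frac (c ^ℚ n) (u ℤ.^ n) (w ℤ.^ n)
frac-pow c zero    _   = frac-one
frac-pow c {u} {w} (suc n) c·w≡u = subst₂ (Frac (c ^ℚ (suc n))) (ℤP.*-comm (u ℤ.^ n) u) (ℤP.*-comm (w ℤ.^ n) w)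
  (frac-* (c ^ℚ n) c (frac-pow c n c·w≡u) c·w≡u)

pochNum : ℚ → ℕ → ℤ
pochNum x = progProduct (↥ x) (↧ x)

frac-poch : ∀ x n → Frac (poch x n) (pochNum x n) (↧ x ℤ.^ n)
frac-poch x zero    = frac-one
frac-poch x (suc n) = subst (Frac (poch x (suc n)) (pochNum x (suc n))) (ℤP.*-comm (↧ x ℤ.^ n) (↧ x))
  (frac-* (poch x n) (x ℚ.+ ℕ→ℚ n) (frac-poch x n) (frac-+ℕ x n (frac-self x)))

prodℤ : List ℤ → ℤ
prodℤ = foldr ℤ._*_ (+ 1)

frac-prod : ∀ (f : ℚ → ℚ) (g h : ℚ → ℤ) xs → (∀ x → Frac (f x) (g x) (h x)) →
            Frac (prod (map f xs)) (prodℤ (map g xs)) (prodℤ (map h xs))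
frac-prod f g h []       _    = frac-one
frac-prod f g h (x ∷ xs) frac = frac-* (f x) (prod (map f xs)) (frac x) (frac-prod f g h xs frac)

coeffNum coeffDen : List ℚ → List ℚ → ℕ → ℤ
coeffNum αs βs n = prodℤ (map (λ x → pochNum x n) αs) ℤ.* prodℤ (map (λ x → ↧ x ℤ.^ n) βs)
coeffDen αs βs n = prodℤ (map (λ x → ↧ x ℤ.^ n) αs) ℤ.* prodℤ (map (λ x → pochNum x n) βs)

shifted≢0 : ∀ x → ¬ NonPosInt x → ∀ k → ↥ x ℤ.+ (+ k) ℤ.* ↧ x ≢ + 0
shifted≢0 x x∉ℤ≤0 k vanishes = x∉ℤ≤0 (k , x≡-k)
  where
  open ≡-Reasoning
  x+k≡0 : x ℚ.+ ℕ→ℚ k ≡ 0ℚ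
  x+k≡0 = frac-zero (x ℚ.+ ℕ→ℚ k) (subst (λ s → Frac (x ℚ.+ ℕ→ℚ k) s (↧ x)) vanishes (frac-+ℕ x k (frac-self x))) (λ ())
  x≡-k : x ≡ ℚ.- ℕ→ℚ k
  x≡-k = begin
    x                                    ≡⟨ sym (ℚP.+-identityʳ x) ⟩
    x ℚ.+ 0ℚ                             ≡⟨ cong (ℚ._+_ x) (sym (ℚP.+-inverseʳ (ℕ→ℚ k))) ⟩
    x ℚ.+ (ℕ→ℚ k ℚ.- ℕ→ℚ k)              ≡⟨ sym (ℚP.+-assoc x (ℕ→ℚ k) _) ⟩
    (x ℚ.+ ℕ→ℚ k) ℚ.+ ℚ.- ℕ→ℚ k          ≡⟨ cong (ℚ._+ ℚ.- ℕ→ℚ k) x+k≡0 ⟩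
    0ℚ ℚ.+ ℚ.- ℕ→ℚ k                     ≡⟨ ℚP.+-identityˡ _ ⟩
    ℚ.- ℕ→ℚ k                            ∎

*-≢0 : ∀ {i j} → i ≢ + 0 → j ≢ + 0 → i ℤ.* j ≢ + 0
*-≢0 {i} i≢0 j≢0 ij≡0 with ℤP.i*j≡0⇒i≡0∨j≡0 i ij≡0
... | inj₁ i≡0 = i≢0 i≡0
... | inj₂ j≡0 = j≢0 j≡0

progProduct-≢0 : ∀ b e → (∀ k → b ℤ.+ (+ k) ℤ.* e ≢ + 0) → ∀ n → progProduct b e n ≢ + 0
progProduct-≢0 b e nonvanishing zero    ()
progProduct-≢0 b e nonvanishing (suc n) = *-≢0 (progProduct-≢0 b e nonvanishing n) (nonvanishing n)

prodℤ-≢0 : ∀ {A : Set} (g : A → ℤ) xs → All (λ x → g x ≢ + 0) xs → prodℤ (map g xs) ≢ + 0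
prodℤ-≢0 g []       []           ()
prodℤ-≢0 g (x ∷ xs) (gx≢0 ∷ all≢0) = *-≢0 gx≢0 (prodℤ-≢0 g xs all≢0)

frac-hypCoeff : ∀ αs βs → All (λ b → ¬ NonPosInt b) βs → ∀ n → Frac (hypCoeff αs βs n) (coeffNum αs βs n) (coeffDen αs βs n)
frac-hypCoeff αs βs βs∉ℤ≤0 n = frac-* (prod (map (λ x → poch x n) αs)) (inv (prod (map (λ x → poch x n) βs)))
  (frac-prod (λ x → poch x n) (λ x → pochNum x n) (λ x → ↧ x ℤ.^ n) αs (λ x → frac-poch x n))
  (frac-inv (prod (map (λ x → poch x n) βs))
    (frac-prod (λ x → poch x n) (λ x → pochNum x n) (λ x → ↧ x ℤ.^ n) βs (λ x → frac-poch x n))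
    (prodℤ-≢0 (λ x → pochNum x n) βs (All-map (λ {x} x∉ℤ≤0 → progProduct-≢0 (↥ x) (↧ x) (shifted≢0 x x∉ℤ≤0) n) βs∉ℤ≤0)))

^-expBound : ∀ {p} → Prime p → ∀ d → d ≢ 0 → ∀ n → ExpBound p ∣ (+ d) ℤ.^ n ∣ (n * d)
^-expBound pp d d≢0 zero    = expBound-one pp
^-expBound pp d d≢0 (suc n) =
  (expBound-*ℤ pp (+ d) ((+ d) ℤ.^ n) (expBound-self pp d d≢0) (^-expBound pp d d≢0 n))

prodℤ-expBound : ∀ {p} → Prime p → ∀ {A : Set} (g : A → ℤ) (K : A → ℕ) n xs →
  All (λ x → ExpBound p ∣ g x ∣ (n * K x)) xs → ExpBound p ∣ prodℤ (map g xs) ∣ (n * sum (map K xs))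
prodℤ-expBound pp g K n []       []       = expBound-weaken (expBound-one pp) z≤n
prodℤ-expBound {p} pp g K n (x ∷ xs) (bx ∷ bxs) = subst (ExpBound p _) (sym (*-distribˡ-+ n (K x) (sum (map K xs))))
  (expBound-*ℤ pp (g x) (prodℤ (map g xs)) bx (prodℤ-expBound pp g K n xs bxs))

-- The constant K with v_p(coeffDen n) ≤ n K for every prime p.
coeffWeight : List ℚ → List ℚ → ℕ
coeffWeight αs βs = sum (map ↧ₙ_ αs) + sum (map (λ x → suc (∣ ↥ x ∣ + ↧ₙ x)) βs)

coeffDen-expBound : ∀ αs βs → All (λ b → ¬ NonPosInt b) βs → ∀ {p} → Prime p → ∀ n →
  ExpBound p ∣ coeffDen αs βs n ∣ (n * coeffWeight αs βs)
coeffDen-expBound αs βs βs∉ℤ≤0 {p} pp n =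
  subst (ExpBound p _) (sym (*-distribˡ-+ n _ _))
    (expBound-*ℤ pp (prodℤ (map (λ x → ↧ x ℤ.^ n) αs)) (prodℤ (map (λ x → pochNum x n) βs))
      (prodℤ-expBound pp (λ x → ↧ x ℤ.^ n) ↧ₙ_ n αs (allOf αs (λ x → ^-expBound pp (↧ₙ x) (λ ()) n)))
      (prodℤ-expBound pp (λ x → pochNum x n) (λ x → suc (∣ ↥ x ∣ + ↧ₙ x)) n βs
        (All-map (λ {x} x∉ℤ≤0 → progProduct-expBound p pp (↥ x) (↧ₙ x) (shifted≢0 x x∉ℤ≤0) (coprime x) n) βs∉ℤ≤0)))
  where
  allOf : ∀ {P : ℚ → Set} xs → (∀ x → P x) → All P xs
  allOf []       _ = []
  allOf (x ∷ xs) h = h x ∷ allOf xs h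
  coprime : ∀ x → Coprime ∣ ↥ x ∣ (↧ₙ x)
  coprime (mkℚ _ _ cop) = recompute cop

IntegralAbove : ℕ → (ℕ → ℚ) → Set
IntegralAbove C₀ a = ∀ p → Prime p → p ≥ C₀ → ∀ n → InZp p (a n)

prime∣^⇒prime∣ : ∀ {p} → Prime p → ∀ u n → p ∣ ∣ u ℤ.^ n ∣ → p ∣ ∣ u ∣
prime∣^⇒prime∣ pp u zero    p∣1 = contradiction (∣⇒≤ p∣1) (<⇒≱ (prime⇒≥2 pp))
prime∣^⇒prime∣ pp u (suc n) p∣uⁿ⁺¹ with euclidsLemma ∣ u ∣ ∣ u ℤ.^ n ∣ pp (subst (_ ∣_) (ℤP.abs-* u (u ℤ.^ n)) p∣uⁿ⁺¹)
... | inj₁ p∣u  = p∣u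
... | inj₂ p∣uⁿ = prime∣^⇒prime∣ pp u n p∣uⁿ

-- If c^n a is an integer, every prime dividing the denominator of a divides the numerator of c:
-- writing c = u/w, the denominator of a divides u^n.
integralMultiple⇒prime∣num : ∀ c a n m → c ^ℚ n ℚ.* a ≡ m ℚ./ 1 → ∀ {p} → Prime p → p ∣ ↧ₙ a → p ∣ ∣ ↥ c ∣
integralMultiple⇒prime∣num c a n m cⁿa≡m pp p∣den = prime∣^⇒prime∣ pp (↥ c) n
  (∣-trans p∣den (den∣frac a (frac-quotient a (c ^ℚ n) m (frac-pow c n (frac-self c)) cⁿa≡m)))

NIntegral⇒integralAbove : ∀ a → NIntegral a → ∃[ C₀ ] IntegralAbove C₀ a
NIntegral⇒integralAbove a (c , c≢0 , cⁿa∈ℤ) = suc ∣ ↥ c ∣ , λ p pp ∣u∣<p n p∣den →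
  <-irrefl refl (≤-trans ∣u∣<p (∣⇒≤ {{≢-nonZero ∣u∣≢0}}
    (integralMultiple⇒prime∣num c (a n) n (proj₁ (cⁿa∈ℤ n)) (proj₂ (cⁿa∈ℤ n)) pp p∣den)))
  where
  ∣u∣≢0 : ∣ ↥ c ∣ ≢ 0
  ∣u∣≢0 ∣u∣≡0 = c≢0 (ℚP.↥p≡0⇒p≡0 c (ℤP.∣i∣≡0⇒i≡0 ∣u∣≡0))

-- (⇐), for any series whose coefficients are fractions N_n / D_n with v_p(D_n) ≤ n K for
-- every prime p: if all coefficients are p-integral for p ≥ C₀, then every prime power
-- dividing den(a_n) divides L^n with L = (C₀!)^K, so c = L works.
linearDenominators⇒NIntegral : ∀ (a : ℕ → ℚ) (N D : ℕ → ℤ) K →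
  (∀ n → Frac (a n) (N n) (D n)) → (∀ {p} → Prime p → ∀ n → ExpBound p ∣ D n ∣ (n * K)) →
  ∃[ C₀ ] IntegralAbove C₀ a → NIntegral a
linearDenominators⇒NIntegral a N D K frac valuation (C₀ , integralAbove) =
  ℕ→ℚ L , L≢0 , λ n → subst IsInt (cong (ℚ._* a n) (sym (ℕ→ℚ-^ L n))) (den∣⇒integral (a n) (L ^ n) (den∣Lⁿ n))
  where
  L : ℕ
  L = (C₀ !) ^ K
  L≢0 : ℕ→ℚ L ≢ 0ℚ
  L≢0 L≡0 = ≢-nonZero⁻¹ L {{m^n≢0 (C₀ !) K {{C₀ !≢0}}}} (cong ∣_∣ (int-injective (+ L) (+ 0) L≡0))
  Lⁿ≡ : ∀ n → L ^ n ≡ (C₀ !) ^ (n * K)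
  Lⁿ≡ n = trans (^-*-assoc (C₀ !) K n) (cong ((C₀ !) ^_) (*-comm K n))
  den∣Lⁿ : ∀ n → ↧ₙ (a n) ∣ L ^ n
  den∣Lⁿ n = primePowers-divide (↧ₙ (a n)) (L ^ n) primePower∣Lⁿ
    where
    primePower∣Lⁿ : ∀ q e → Prime q → q ^ e ∣ ↧ₙ (a n) → q ^ e ∣ L ^ n
    primePower∣Lⁿ q zero    _  _        = 1∣ _
    primePower∣Lⁿ q (suc e) pq qᵉ⁺¹∣den = subst (q ^ suc e ∣_) (sym (Lⁿ≡ n))
      (smallPrimePower∣factorial^ (suc e) (n * K) pq q<C₀ (valuation pq n (suc e) (∣-trans qᵉ⁺¹∣den (den∣frac (a n) (frac n)))))
      where
      q<C₀ : q < C₀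
      q<C₀ = ≰⇒> (λ C₀≤q → integralAbove q pq C₀≤q n (m*n∣⇒m∣ q (q ^ e) qᵉ⁺¹∣den))

-- F_{α,β} is N-integral iff its coefficients are p-integral for all sufficiently large primes p.
proposition1 : (αs βs : List ℚ) →
    All (λ a → ¬ NonPosInt a) αs → All (λ b → ¬ NonPosInt b) βs →
    NIntegral (hypCoeff αs βs) ⇔
      (∃[ C₀ ] (∀ p → Prime p → p ≥ C₀ → ∀ n → InZp p (hypCoeff αs βs n)))
proposition1 αs βs _ βs∉ℤ≤0 = mk⇔
  (NIntegral⇒integralAbove (hypCoeff αs βs))
  (linearDenominators⇒NIntegral (hypCoeff αs βs) (coeffNum αs βs) (coeffDen αs βs) (coeffWeight αs βs)
    (frac-hypCoeff αs βs βs∉ℤ≤0) (coeffDen-expBound αs βs βs∉ℤ≤0))
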